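{- For every real number $M>0$ there exist a finite transitive permutation group $G\leqslant \mathrm{Sym}(\Omega)$ and an intersecting set $S\subseteq G$ such that $|S|>M\,|G_\omega|$, where $G_\omega$ is the stabilizer of a point $\omega\in\Omega$.
   Context: Let $G\leqslant\mathrm{Sym}(\Omega)$ be a finite permutation group. Two elements $x,y\in G$ are said to intersect if there is a point $\alpha\in\Omega$ with $\alpha^{xy^{ -1}}=\alpha$. A subset $S\subseteq G$ is an intersecting set if every pair of elements of $S$ intersect.
   Formalization: The number M ranges over the positive rationals instead of the positive reals. -}

module Defs where

open import Data.Nat using (ℕ)
open import Data.Fin using (Fin; _≟_)
open import Data.Fin.Permutation using (Permutation′; _⟨$⟩ʳ_; _≈_; id; flip; _∘ₚ_)
open import Data.List using (List; length; filter)
open import Data.List.Relation.Unary.Any using (Any)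
open import Data.List.Relation.Unary.All using (All)
open import Data.List.Relation.Unary.AllPairs using (AllPairs)
open import Data.Product using (Σ; _×_; ∃)
open import Relation.Binary.PropositionalEquality using (_≡_)
open import Relation.Nullary using (¬_)

-- Permutations of Ω = Fin n, composed with the right-action convention:
-- α ^ (x ∘ₚ y) = (α ^ x) ^ y, i.e. x is applied first.

_∈ₚ_ : ∀ {n} → Permutation′ n → List (Permutation′ n) → Set
π ∈ₚ gs = Any (λ g → π ≈ g) gs

Distinct : ∀ {n} → List (Permutation′ n) → Set
Distinct gs = AllPairs (λ g h → ¬ (g ≈ h)) gs

record PermGroup (n : ℕ) : Set where
  field
    elems     : List (Permutation′ n)
    distinct  : Distinct elems
    has-id    : id ∈ₚ elems
    mul-closed : ∀ g h → g ∈ₚ elems → h ∈ₚ elems → (g ∘ₚ h) ∈ₚ elems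
    inv-closed : ∀ g → g ∈ₚ elems → flip g ∈ₚ elems

open PermGroup public

order : ∀ {n} → PermGroup n → ℕ
order G = length (elems G)

Transitive : ∀ {n} → PermGroup n → Set
Transitive {n} G = ∀ (α β : Fin n) → Σ (Permutation′ n) λ g → (g ∈ₚ elems G) × (g ⟨$⟩ʳ α ≡ β)

stabiliser : ∀ {n} → PermGroup n → Fin n → List (Permutation′ n)
stabiliser G ω = filter (λ g → (g ⟨$⟩ʳ ω) ≟ ω) (elems G)

Intersect : ∀ {n} → Permutation′ n → Permutation′ n → Set
Intersect {n} x y = ∃ λ (α : Fin n) → (x ∘ₚ flip y) ⟨$⟩ʳ α ≡ α

IntersectingSet : ∀ {n} → PermGroup n → List (Permutation′ n) → Set
IntersectingSet G S =
  Distinct S × All (λ s → s ∈ₚ elems G) S ×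
  All (λ x → All (λ y → Intersect x y) S) S

module Submission where

open import Defs
open import Data.Nat using (ℕ)
open import Data.Fin using (Fin)
open import Data.Fin.Permutation using (Permutation′)
open import Data.List using (List; length)
open import Data.Product using (Σ; _×_)
open import Data.Integer using (+_)
open import Data.Rational using (ℚ; 0ℚ; _<_; _*_; _/_)

open import Level using (0ℓ)
open import Data.Nat as ℕ using (zero; suc; _^_)
open import Data.Nat.Properties as ℕₚ using (+-mono-≤; ≤-trans; m≤m+n; m^n>0; m^n≢0)
open import Data.Fin as Fin using (_≟_; combine; remQuot; #_)
open import Data.Fin.Properties using (all?; any?; *↔×; remQuot-combine; combine-remQuot; combine-injective)
open import Data.Fin.Permutation using (_⟨$⟩ʳ_; _⟨$⟩ˡ_; _≈_; id; flip; _∘ₚ_; permutation; inverseˡ; inverseʳ)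
open import Data.List using ([]; _∷_; map; filter; _++_; cartesianProductWith)
open import Data.List.Properties using (length-++; length-map; filter-++; filter-accept; filter-reject; filter-none)
open import Data.List.Relation.Unary.Any as Any using (Any)
open import Data.List.Relation.Unary.All as All using (All; []; _∷_)
import Data.List.Relation.Unary.All.Properties as Allₚ
import Data.List.Membership.Setoid as SetoidMembership
import Data.List.Membership.Setoid.Properties as SetoidMembershipₚ
import Data.List.Membership.DecSetoid as DecSetoidMembership
import Data.List.Relation.Unary.Unique.Setoid.Properties as Uniqueₚ
import Data.List.Relation.Unary.Unique.DecSetoid as DecUnique
open import Data.Product using (_,_; proj₁; proj₂; ∃₂; uncurry)
open import Data.Product.Function.NonDependent.Propositional using (_×-↔_)
open import Data.Vec using (Vec; lookup) renaming ([] to []ᵥ; _∷_ to _∷ᵥ_)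
open import Function using (_∘_; _⇔_; Equivalence)
open import Function.Construct.Composition using (_↔-∘_)
open import Function.Construct.Symmetry using (↔-sym)
open import Relation.Binary.Bundles using (Setoid; DecSetoid)
open import Relation.Binary.PropositionalEquality using (_≡_; refl; sym; trans; cong; cong₂; subst; subst₂; module ≡-Reasoning)
open import Relation.Nullary using (¬_; Dec; yes; no; _×-dec_)
open import Relation.Nullary.Decidable using (True; toWitness)
open import Relation.Unary using (Decidable)
import Data.Integer as ℤ
open import Data.Integer using (+[1+_])
import Data.Integer.Properties as ℤₚ
import Data.Nat.Coprimality as Coprimality
open import Data.Rational using (mkℚ; ↥_) renaming (*<* to ℚ*<*)
open import Data.Rational.Properties using (normalize-coprime; toℚᵘ-cancel-<; toℚᵘ-homo-*)
import Data.Rational.Unnormalised as ℚᵘ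
import Data.Rational.Unnormalised.Properties as ℚᵘₚ

-- The ratio  |S| / |G_ω|  is multiplicative under direct
-- products: if G ≤ Sym(Ω) and H ≤ Sym(Δ) are transitive with intersecting
-- sets S and T, then G × H acting on Ω × Δ is transitive, S × T is
-- intersecting, and (G × H)_(ω,δ) = G_ω × H_δ.  The alternating group A₄
-- acting on the six 2-subsets of {1,2,3,4} has point stabilisers of order 2,
-- and its Klein four-subgroup V₄ is intersecting (every element of V₄ fixes
-- a 2-subset).  So A₄ᵏ acting on 6ᵏ points has stabilisers of order 2ᵏ and an
-- intersecting set of size 4ᵏ = 2ᵏ·2ᵏ, which exceeds M·2ᵏ as soon as
-- 2ᵏ > numerator(M) ≥ M; we take k = numerator(M).

-- Pointwise equality makes the permutations of Fin n a setoid; '_∈ₚ_' and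
-- 'Distinct' from Defs are its list membership and uniqueness predicates.
PermSetoid : ℕ → Setoid 0ℓ 0ℓ
PermSetoid n = record
  { Carrier       = Permutation′ n
  ; _≈_           = _≈_
  ; isEquivalence = record
    { refl  = λ _ → refl
    ; sym   = λ p i → sym (p i)
    ; trans = λ p q i → trans (p i) (q i)
    }
  }

PermDecSetoid : ℕ → DecSetoid 0ℓ 0ℓ
PermDecSetoid n = record
  { Carrier          = Permutation′ n
  ; _≈_              = _≈_
  ; isDecEquivalence = record
    { isEquivalence = Setoid.isEquivalence (PermSetoid n)
    ; _≟_           = λ π σ → all? λ i → π ⟨$⟩ʳ i ≟ σ ⟨$⟩ʳ i
    }
  }

module _ {n : ℕ} where

  _∈?_ : (π : Permutation′ n) (gs : List (Permutation′ n)) → Dec (π ∈ₚ gs)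
  _∈?_ = DecSetoidMembership._∈?_ (PermDecSetoid n)

  distinct? : (gs : List (Permutation′ n)) → Dec (Distinct gs)
  distinct? = DecUnique.unique? (PermDecSetoid n)

  ∘ₚ-cong : ∀ {g g′ h h′ : Permutation′ n} → g ≈ g′ → h ≈ h′ → (g ∘ₚ h) ≈ (g′ ∘ₚ h′)
  ∘ₚ-cong {h = h} g≈g′ h≈h′ i = trans (cong (h ⟨$⟩ʳ_) (g≈g′ i)) (h≈h′ _)

  flip-cong : ∀ {g g′ : Permutation′ n} → g ≈ g′ → flip g ≈ flip g′
  flip-cong {g} {g′} g≈g′ i = begin
    g ⟨$⟩ˡ i                      ≡⟨ inverseˡ g′ ⟨
    g′ ⟨$⟩ˡ (g′ ⟨$⟩ʳ (g ⟨$⟩ˡ i))  ≡⟨ cong (g′ ⟨$⟩ˡ_) (g≈g′ _) ⟨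
    g′ ⟨$⟩ˡ (g ⟨$⟩ʳ (g ⟨$⟩ˡ i))   ≡⟨ cong (g′ ⟨$⟩ˡ_) (inverseʳ g) ⟩
    g′ ⟨$⟩ˡ i                     ∎
    where open ≡-Reasoning

  ∈-resp-≈ : ∀ {π σ : Permutation′ n} {gs} → π ≈ σ → π ∈ₚ gs → σ ∈ₚ gs
  ∈-resp-≈ {π} {σ} {gs} = SetoidMembershipₚ.∈-resp-≈ (PermSetoid n) {gs} {π} {σ}

tabulatePerm : ∀ {n} (f f⁻¹ : Vec (Fin n) n) →
  {_ : True (all? λ y → lookup f (lookup f⁻¹ y) ≟ y)} →
  {_ : True (all? λ y → lookup f⁻¹ (lookup f y) ≟ y)} → Permutation′ n
tabulatePerm f f⁻¹ {p} {q} = permutation (lookup f) (lookup f⁻¹) (toWitness p) (toWitness q)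

module _ {n : ℕ} (gs : List (Permutation′ n)) where

  MulClosed : Set
  MulClosed = All (λ g → All (λ h → (g ∘ₚ h) ∈ₚ gs) gs) gs

  InvClosed : Set
  InvClosed = All (λ g → flip g ∈ₚ gs) gs

  mulClosed? : Dec MulClosed
  mulClosed? = All.all? (λ g → All.all? (λ h → (g ∘ₚ h) ∈? gs) gs) gs

  invClosed? : Dec InvClosed
  invClosed? = All.all? (λ g → flip g ∈? gs) gs

  -- The checks give the closure axioms for every element up to ≈, since
  -- the checked properties respect pointwise equality.
  MulClosed⇒closed : MulClosed → ∀ g h → g ∈ₚ gs → h ∈ₚ gs → (g ∘ₚ h) ∈ₚ gs
  MulClosed⇒closed closed g h g∈ h∈ =
    All.lookupₛ (PermSetoid n) {P = λ h → (g ∘ₚ h) ∈ₚ gs} {xs = gs} (λ {h} {h′} → right-resp {h} {h′})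
      (All.lookupₛ (PermSetoid n) {P = λ g → All (λ h → (g ∘ₚ h) ∈ₚ gs) gs} {xs = gs} (λ {g} {g′} → left-resp {g} {g′}) closed {g} g∈)
      {h} h∈
    where
    right-resp : ∀ {h h′} → h ≈ h′ → (g ∘ₚ h) ∈ₚ gs → (g ∘ₚ h′) ∈ₚ gs
    right-resp {h} {h′} h≈h′ = ∈-resp-≈ {π = g ∘ₚ h} {σ = g ∘ₚ h′} (∘ₚ-cong {g = g} {g} {h} {h′} (λ _ → refl) h≈h′)

    left-resp : ∀ {g g′} → g ≈ g′ → All (λ h → (g ∘ₚ h) ∈ₚ gs) gs → All (λ h → (g′ ∘ₚ h) ∈ₚ gs) gs
    left-resp {g} {g′} g≈g′ = All.map λ {h} →
      ∈-resp-≈ {π = g ∘ₚ h} {σ = g′ ∘ₚ h} (∘ₚ-cong {g = g} {g′} {h} {h} g≈g′ (λ _ → refl))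

  InvClosed⇒closed : InvClosed → ∀ g → g ∈ₚ gs → flip g ∈ₚ gs
  InvClosed⇒closed closed g g∈ =
    All.lookupₛ (PermSetoid n) {P = λ g → flip g ∈ₚ gs} {xs = gs}
      (λ {g} {g′} g≈g′ → ∈-resp-≈ {π = flip g} {σ = flip g′} (flip-cong {g = g} {g′} g≈g′))
      closed {g} g∈

listGroup : ∀ {n} (gs : List (Permutation′ n)) →
  {_ : True (distinct? gs)} → {_ : True (id ∈? gs)} →
  {_ : True (mulClosed? gs)} → {_ : True (invClosed? gs)} → PermGroup n
listGroup gs {d} {e} {m} {i} = record
  { elems      = gs
  ; distinct   = toWitness d
  ; has-id     = toWitness e
  ; mul-closed = MulClosed⇒closed gs (toWitness m)
  ; inv-closed = InvClosed⇒closed gs (toWitness i)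
  }

module _ {n : ℕ} (G : PermGroup n) where

  OrbitCheck : Set
  OrbitCheck = ∀ α β → Any (λ g → g ⟨$⟩ʳ α ≡ β) (elems G)

  orbitCheck? : Dec OrbitCheck
  orbitCheck? = all? λ α → all? λ β → Any.any? (λ g → g ⟨$⟩ʳ α ≟ β) (elems G)

  OrbitCheck⇒transitive : OrbitCheck → Transitive G
  OrbitCheck⇒transitive check α β = SetoidMembership.find (PermSetoid n) (check α β)

  intersectingSet? : (S : List (Permutation′ n)) → Dec (IntersectingSet G S)
  intersectingSet? S =
    distinct? S ×-dec All.all? (_∈? elems G) S ×-dec
    All.all? (λ x → All.all? (λ y → any? λ α → (x ∘ₚ flip y) ⟨$⟩ʳ α ≟ α) S) S

module _ {n m : ℕ} where

  -- The product permutation g ⊗ h acts on Fin (n·m) ≅ Fin n × Fin m by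
  -- (a , b) ↦ (g a , h b), transported along the library bijection *↔×.
  _⊗_ : Permutation′ n → Permutation′ m → Permutation′ (n ℕ.* m)
  g ⊗ h = ↔-sym *↔× ↔-∘ ((g ×-↔ h) ↔-∘ *↔×)

  ⊗-combine : ∀ g h (a : Fin n) (b : Fin m) →
    (g ⊗ h) ⟨$⟩ʳ combine a b ≡ combine (g ⟨$⟩ʳ a) (h ⟨$⟩ʳ b)
  ⊗-combine g h a b =
    cong (uncurry λ a′ b′ → combine (g ⟨$⟩ʳ a′) (h ⟨$⟩ʳ b′)) (remQuot-combine a b)

  ⊗-cong : ∀ {g g′ h h′} → g ≈ g′ → h ≈ h′ → (g ⊗ h) ≈ (g′ ⊗ h′)
  ⊗-cong g≈g′ h≈h′ i = cong₂ combine (g≈g′ _) (h≈h′ _)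

  -- Over non-empty sets, g ⊗ h determines g and h (up to ≈).
  ⊗-injective : Fin n → Fin m → ∀ {g g′ h h′} → (g ⊗ h) ≈ (g′ ⊗ h′) → (g ≈ g′) × (h ≈ h′)
  ⊗-injective a₀ b₀ {g} {g′} {h} {h′} eq =
    (λ a → proj₁ (components a b₀)) , (λ b → proj₂ (components a₀ b))
    where
    components : ∀ a b → (g ⟨$⟩ʳ a ≡ g′ ⟨$⟩ʳ a) × (h ⟨$⟩ʳ b ≡ h′ ⟨$⟩ʳ b)
    components a b = combine-injective _ _ _ _ (begin
      combine (g ⟨$⟩ʳ a) (h ⟨$⟩ʳ b)    ≡⟨ ⊗-combine g h a b ⟨
      (g ⊗ h) ⟨$⟩ʳ combine a b        ≡⟨ eq (combine a b) ⟩
      (g′ ⊗ h′) ⟨$⟩ʳ combine a b      ≡⟨ ⊗-combine g′ h′ a b ⟩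
      combine (g′ ⟨$⟩ʳ a) (h′ ⟨$⟩ʳ b)  ∎)
      where open ≡-Reasoning

  id-⊗ : id ≈ (id ⊗ id)
  id-⊗ i = sym (combine-remQuot {n} m i)

  ∘ₚ-⊗ : ∀ a b c d → ((a ⊗ b) ∘ₚ (c ⊗ d)) ≈ ((a ∘ₚ c) ⊗ (b ∘ₚ d))
  ∘ₚ-⊗ a b c d i = ⊗-combine c d _ _

  flip-⊗ : ∀ a b → flip (a ⊗ b) ≈ (flip a ⊗ flip b)
  flip-⊗ a b i = refl

  ⊗-fixes : ∀ g h a b →
    ((g ⊗ h) ⟨$⟩ʳ combine a b ≡ combine a b) ⇔ ((g ⟨$⟩ʳ a ≡ a) × (h ⟨$⟩ʳ b ≡ b))
  ⊗-fixes g h a b = record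
    { to        = λ fixed → combine-injective _ _ a b (trans (sym (⊗-combine g h a b)) fixed)
    ; from      = λ { (ga≡a , hb≡b) → trans (⊗-combine g h a b) (cong₂ combine ga≡a hb≡b) }
    ; to-cong   = λ { refl → refl }
    ; from-cong = λ { refl → refl }
    }

  intersect-⊗ : ∀ x y x′ y′ → Intersect x x′ → Intersect y y′ → Intersect (x ⊗ y) (x′ ⊗ y′)
  intersect-⊗ x y x′ y′ (a , fixa) (b , fixb) =
    combine a b ,
    trans (∘ₚ-⊗ x y (flip x′) (flip y′) (combine a b))
          (Equivalence.from (⊗-fixes (x ∘ₚ flip x′) (y ∘ₚ flip y′) a b) (fixa , fixb))

count : ∀ {D : Set} {S : D → Set} → Decidable S → List D → ℕ
count S? ds = length (filter S? ds)

module _ {A B C : Set} (f : A → B → C) where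

  length-cartesianProductWith : ∀ xs ys →
    length (cartesianProductWith f xs ys) ≡ length xs ℕ.* length ys
  length-cartesianProductWith []       ys = refl
  length-cartesianProductWith (x ∷ xs) ys = begin
    length (map (f x) ys ++ cartesianProductWith f xs ys)
      ≡⟨ length-++ (map (f x) ys) ⟩
    length (map (f x) ys) ℕ.+ length (cartesianProductWith f xs ys)
      ≡⟨ cong₂ ℕ._+_ (length-map (f x) ys) (length-cartesianProductWith xs ys) ⟩
    length ys ℕ.+ length xs ℕ.* length ys
      ∎
    where open ≡-Reasoning

  module _ {P : A → Set} {Q : B → Set} {R : C → Set}
           (P? : Decidable P) (Q? : Decidable Q) (R? : Decidable R)
           (R-split : ∀ x y → R (f x y) ⇔ (P x × Q y)) where

    count-row-accept : ∀ {x} → P x → ∀ ys → count R? (map (f x) ys) ≡ count Q? ys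
    count-row-accept px [] = refl
    count-row-accept {x} px (y ∷ ys) with Q? y
    ... | yes qy = trans (cong length (filter-accept R? (Equivalence.from (R-split x y) (px , qy))))
                         (cong suc (count-row-accept px ys))
    ... | no ¬qy = trans (cong length (filter-reject R? (¬qy ∘ proj₂ ∘ Equivalence.to (R-split x y))))
                         (count-row-accept px ys)

    count-row-reject : ∀ {x} → ¬ P x → ∀ ys → count R? (map (f x) ys) ≡ 0
    count-row-reject {x} ¬px ys = cong length (filter-none R?
      (Allₚ.map⁺ (All.universal (λ y → ¬px ∘ proj₁ ∘ Equivalence.to (R-split x y)) ys)))

    count-cartesianProductWith : ∀ xs ys →
      count R? (cartesianProductWith f xs ys) ≡ count P? xs ℕ.* count Q? ys
    count-cartesianProductWith []       ys = refl
    count-cartesianProductWith (x ∷ xs) ys = begin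
      count R? (map (f x) ys ++ cartesianProductWith f xs ys)
        ≡⟨ cong length (filter-++ R? (map (f x) ys) _) ⟩
      length (filter R? (map (f x) ys) ++ filter R? (cartesianProductWith f xs ys))
        ≡⟨ length-++ (filter R? (map (f x) ys)) ⟩
      count R? (map (f x) ys) ℕ.+ count R? (cartesianProductWith f xs ys)
        ≡⟨ cong (count R? (map (f x) ys) ℕ.+_) (count-cartesianProductWith xs ys) ⟩
      count R? (map (f x) ys) ℕ.+ count P? xs ℕ.* count Q? ys
        ≡⟨ row ⟩
      count P? (x ∷ xs) ℕ.* count Q? ys
        ∎
      where
      open ≡-Reasoning
      row : count R? (map (f x) ys) ℕ.+ count P? xs ℕ.* count Q? ys ≡ count P? (x ∷ xs) ℕ.* count Q? ys
      row with P? x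
      ... | yes px = cong (ℕ._+ count P? xs ℕ.* count Q? ys) (count-row-accept px ys)
      ... | no ¬px = cong (ℕ._+ count P? xs ℕ.* count Q? ys) (count-row-reject ¬px ys)

module _ {n m : ℕ} where

  _⊠_ : List (Permutation′ n) → List (Permutation′ m) → List (Permutation′ (n ℕ.* m))
  gs ⊠ hs = cartesianProductWith _⊗_ gs hs

  ∈-⊠⁺ : ∀ {gs hs} g h → g ∈ₚ gs → h ∈ₚ hs → (g ⊗ h) ∈ₚ (gs ⊠ hs)
  ∈-⊠⁺ {gs} {hs} g h =
    SetoidMembershipₚ.∈-cartesianProductWith⁺ (PermSetoid n) (PermSetoid m) (PermSetoid (n ℕ.* m))
    (λ {g} {g′} {h} {h′} → ⊗-cong {g = g} {g′} {h} {h′}) {gs} {hs} {g} {h}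

  ∈-⊠⁻ : ∀ {π} gs hs → π ∈ₚ (gs ⊠ hs) →
    ∃₂ λ g h → g ∈ₚ gs × h ∈ₚ hs × π ≈ (g ⊗ h)
  ∈-⊠⁻ {π} gs hs =
    SetoidMembershipₚ.∈-cartesianProductWith⁻ (PermSetoid n) (PermSetoid m) (PermSetoid (n ℕ.* m))
      _⊗_ gs hs {π}

  distinct-⊠ : Fin n → Fin m → ∀ {gs hs} → Distinct gs → Distinct hs → Distinct (gs ⊠ hs)
  distinct-⊠ a₀ b₀ {gs} {hs} =
    Uniqueₚ.cartesianProductWith⁺ (PermSetoid n) (PermSetoid m) (PermSetoid (n ℕ.* m)) {gs} {hs} _⊗_ (λ {g} {g′} {h} {h′} → ⊗-injective a₀ b₀ {g = g} {g′} {h} {h′})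

  All-⊠ : ∀ {P : Permutation′ n → Set} {Q : Permutation′ m → Set} {R : Permutation′ (n ℕ.* m) → Set} {gs hs} →
    (∀ g h → P g → Q h → R (g ⊗ h)) → All P gs → All Q hs → All R (gs ⊠ hs)
  All-⊠              PQ⇒R []         qs = []
  All-⊠ {gs = g ∷ _} PQ⇒R (pg ∷ pgs) qs =
    Allₚ.++⁺ (Allₚ.map⁺ (All.map (λ {h} → PQ⇒R g h pg) qs)) (All-⊠ PQ⇒R pgs qs)

-- The direct product G × H acting on Fin n × Fin m ≅ Fin (n·m); the points
-- a₀ and b₀ witness that both sets are non-empty (making ⊗ injective) and
-- give the base point (a₀ , b₀) whose stabiliser is computed.
module DirectProduct {n m : ℕ} (a₀ : Fin n) (b₀ : Fin m) (G : PermGroup n) (H : PermGroup m) where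

  group : PermGroup (n ℕ.* m)
  group = record
    { elems      = elems G ⊠ elems H
    ; distinct   = distinct-⊠ a₀ b₀ (distinct G) (distinct H)
    ; has-id     = ∈-resp-≈ {π = _⊗_ {n} {m} id id} {σ = id} (λ i → sym (id-⊗ {n} {m} i))
                     (∈-⊠⁺ id id (has-id G) (has-id H))
    ; mul-closed = mul-closed′
    ; inv-closed = inv-closed′
    }
    where
    mul-closed′ : ∀ π σ → π ∈ₚ (elems G ⊠ elems H) → σ ∈ₚ (elems G ⊠ elems H) → (π ∘ₚ σ) ∈ₚ (elems G ⊠ elems H)
    mul-closed′ π σ π∈ σ∈ with ∈-⊠⁻ {π = π} (elems G) (elems H) π∈ | ∈-⊠⁻ {π = σ} (elems G) (elems H) σ∈
    ... | a , b , a∈ , b∈ , π≈ | c , d , c∈ , d∈ , σ≈ =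
      ∈-resp-≈ {π = (a ∘ₚ c) ⊗ (b ∘ₚ d)} {σ = π ∘ₚ σ}
        (λ i → sym (trans (∘ₚ-cong {g = π} {a ⊗ b} {σ} {c ⊗ d} π≈ σ≈ i) (∘ₚ-⊗ a b c d i)))
        (∈-⊠⁺ (a ∘ₚ c) (b ∘ₚ d) (mul-closed G a c a∈ c∈) (mul-closed H b d b∈ d∈))

    inv-closed′ : ∀ π → π ∈ₚ (elems G ⊠ elems H) → flip π ∈ₚ (elems G ⊠ elems H)
    inv-closed′ π π∈ with ∈-⊠⁻ {π = π} (elems G) (elems H) π∈
    ... | a , b , a∈ , b∈ , π≈ =
      ∈-resp-≈ {π = flip a ⊗ flip b} {σ = flip π}
        (λ i → sym (trans (flip-cong {g = π} {a ⊗ b} π≈ i) (flip-⊗ a b i)))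
        (∈-⊠⁺ (flip a) (flip b) (inv-closed G a a∈) (inv-closed H b b∈))

  transitive : Transitive G → Transitive H → Transitive group
  transitive trG trH α β with trG (proj₁ (remQuot {n} m α)) (proj₁ (remQuot {n} m β))
                            | trH (proj₂ (remQuot {n} m α)) (proj₂ (remQuot {n} m β))
  ... | g , g∈ , gα≡β | h , h∈ , hα≡β =
    g ⊗ h , ∈-⊠⁺ g h g∈ h∈ , trans (cong₂ combine gα≡β hα≡β) (combine-remQuot {n} m β)

  intersecting : ∀ {S T} → IntersectingSet G S → IntersectingSet H T → IntersectingSet group (S ⊠ T)
  intersecting (S-distinct , S⊆G , S-int) (T-distinct , T⊆H , T-int) =
    distinct-⊠ a₀ b₀ S-distinct T-distinct ,
    All-⊠ ∈-⊠⁺ S⊆G T⊆H ,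
    All-⊠ (λ x y x-int y-int → All-⊠ (intersect-⊗ x y) x-int y-int) S-int T-int

  stabiliser-order : length (stabiliser group (combine a₀ b₀))
                   ≡ length (stabiliser G a₀) ℕ.* length (stabiliser H b₀)
  stabiliser-order = count-cartesianProductWith _⊗_
    (λ g → g ⟨$⟩ʳ a₀ ≟ a₀) (λ h → h ⟨$⟩ʳ b₀ ≟ b₀) (λ π → π ⟨$⟩ʳ combine a₀ b₀ ≟ combine a₀ b₀)
    (λ g h → ⊗-fixes g h a₀ b₀) (elems G) (elems H)

record Example (s t : ℕ) : Set where
  field
    degree       : ℕ
    group        : PermGroup degree
    point        : Fin degree
    set          : List (Permutation′ degree)
    transitive   : Transitive group
    intersecting : IntersectingSet group set
    stab-order   : length (stabiliser group point) ≡ s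
    set-size     : length set ≡ t

product-example : ∀ {s t s′ t′} → Example s t → Example s′ t′ → Example (s ℕ.* s′) (t ℕ.* t′)
product-example E F = record
  { degree       = E.degree ℕ.* F.degree
  ; group        = E×F.group
  ; point        = combine E.point F.point
  ; set          = E.set ⊠ F.set
  ; transitive   = E×F.transitive E.transitive F.transitive
  ; intersecting = E×F.intersecting E.intersecting F.intersecting
  ; stab-order   = trans E×F.stabiliser-order (cong₂ ℕ._*_ E.stab-order F.stab-order)
  ; set-size     = trans (length-cartesianProductWith _⊗_ E.set F.set)
                         (cong₂ ℕ._*_ E.set-size F.set-size)
  }
  where
  module E = Example E
  module F = Example F
  module E×F = DirectProduct E.point F.point E.group F.group

checked-example : ∀ {n} (G : PermGroup n) (S : List (Permutation′ n)) (ω : Fin n) →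
  {_ : True (orbitCheck? G)} → {_ : True (intersectingSet? G S)} →
  Example (length (stabiliser G ω)) (length S)
checked-example {n} G S ω {tr} {int} = record
  { degree       = n
  ; group        = G
  ; point        = ω
  ; set          = S
  ; transitive   = OrbitCheck⇒transitive G (toWitness tr)
  ; intersecting = toWitness int
  ; stab-order   = refl
  ; set-size     = refl
  }

trivial-example : Example 1 1
trivial-example = checked-example (listGroup {1} (id ∷ [])) (id ∷ []) Fin.zero

-- A₄ acting on the six 2-subsets of {1,2,3,4}, numbered lexicographically
-- 0 = {1,2}, 1 = {1,3}, 2 = {1,4}, 3 = {2,3}, 4 = {2,4}, 5 = {3,4}.
-- Each element is given by its table of images and that of its inverse,
-- and is named after the permutation of {1,2,3,4} it induces.
module A₄ where

  e v₁₂ v₁₃ v₁₄ c₂₃₄ c₂₄₃ c₁₂₃ c₁₃₂ c₁₂₄ c₁₄₂ c₁₃₄ c₁₄₃ : Permutation′ 6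
  e    = tabulatePerm (# 0 ∷ᵥ # 1 ∷ᵥ # 2 ∷ᵥ # 3 ∷ᵥ # 4 ∷ᵥ # 5 ∷ᵥ []ᵥ) (# 0 ∷ᵥ # 1 ∷ᵥ # 2 ∷ᵥ # 3 ∷ᵥ # 4 ∷ᵥ # 5 ∷ᵥ []ᵥ)
  v₁₂  = tabulatePerm (# 0 ∷ᵥ # 4 ∷ᵥ # 3 ∷ᵥ # 2 ∷ᵥ # 1 ∷ᵥ # 5 ∷ᵥ []ᵥ) (# 0 ∷ᵥ # 4 ∷ᵥ # 3 ∷ᵥ # 2 ∷ᵥ # 1 ∷ᵥ # 5 ∷ᵥ []ᵥ)
  v₁₃  = tabulatePerm (# 5 ∷ᵥ # 1 ∷ᵥ # 3 ∷ᵥ # 2 ∷ᵥ # 4 ∷ᵥ # 0 ∷ᵥ []ᵥ) (# 5 ∷ᵥ # 1 ∷ᵥ # 3 ∷ᵥ # 2 ∷ᵥ # 4 ∷ᵥ # 0 ∷ᵥ []ᵥ)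
  v₁₄  = tabulatePerm (# 5 ∷ᵥ # 4 ∷ᵥ # 2 ∷ᵥ # 3 ∷ᵥ # 1 ∷ᵥ # 0 ∷ᵥ []ᵥ) (# 5 ∷ᵥ # 4 ∷ᵥ # 2 ∷ᵥ # 3 ∷ᵥ # 1 ∷ᵥ # 0 ∷ᵥ []ᵥ)
  c₂₃₄ = tabulatePerm (# 1 ∷ᵥ # 2 ∷ᵥ # 0 ∷ᵥ # 5 ∷ᵥ # 3 ∷ᵥ # 4 ∷ᵥ []ᵥ) (# 2 ∷ᵥ # 0 ∷ᵥ # 1 ∷ᵥ # 4 ∷ᵥ # 5 ∷ᵥ # 3 ∷ᵥ []ᵥ)
  c₂₄₃ = tabulatePerm (# 2 ∷ᵥ # 0 ∷ᵥ # 1 ∷ᵥ # 4 ∷ᵥ # 5 ∷ᵥ # 3 ∷ᵥ []ᵥ) (# 1 ∷ᵥ # 2 ∷ᵥ # 0 ∷ᵥ # 5 ∷ᵥ # 3 ∷ᵥ # 4 ∷ᵥ []ᵥ)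
  c₁₂₃ = tabulatePerm (# 3 ∷ᵥ # 0 ∷ᵥ # 4 ∷ᵥ # 1 ∷ᵥ # 5 ∷ᵥ # 2 ∷ᵥ []ᵥ) (# 1 ∷ᵥ # 3 ∷ᵥ # 5 ∷ᵥ # 0 ∷ᵥ # 2 ∷ᵥ # 4 ∷ᵥ []ᵥ)
  c₁₃₂ = tabulatePerm (# 1 ∷ᵥ # 3 ∷ᵥ # 5 ∷ᵥ # 0 ∷ᵥ # 2 ∷ᵥ # 4 ∷ᵥ []ᵥ) (# 3 ∷ᵥ # 0 ∷ᵥ # 4 ∷ᵥ # 1 ∷ᵥ # 5 ∷ᵥ # 2 ∷ᵥ []ᵥ)
  c₁₂₄ = tabulatePerm (# 4 ∷ᵥ # 3 ∷ᵥ # 0 ∷ᵥ # 5 ∷ᵥ # 2 ∷ᵥ # 1 ∷ᵥ []ᵥ) (# 2 ∷ᵥ # 5 ∷ᵥ # 4 ∷ᵥ # 1 ∷ᵥ # 0 ∷ᵥ # 3 ∷ᵥ []ᵥ)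
  c₁₄₂ = tabulatePerm (# 2 ∷ᵥ # 5 ∷ᵥ # 4 ∷ᵥ # 1 ∷ᵥ # 0 ∷ᵥ # 3 ∷ᵥ []ᵥ) (# 4 ∷ᵥ # 3 ∷ᵥ # 0 ∷ᵥ # 5 ∷ᵥ # 2 ∷ᵥ # 1 ∷ᵥ []ᵥ)
  c₁₃₄ = tabulatePerm (# 3 ∷ᵥ # 5 ∷ᵥ # 1 ∷ᵥ # 4 ∷ᵥ # 0 ∷ᵥ # 2 ∷ᵥ []ᵥ) (# 4 ∷ᵥ # 2 ∷ᵥ # 5 ∷ᵥ # 0 ∷ᵥ # 3 ∷ᵥ # 1 ∷ᵥ []ᵥ)
  c₁₄₃ = tabulatePerm (# 4 ∷ᵥ # 2 ∷ᵥ # 5 ∷ᵥ # 0 ∷ᵥ # 3 ∷ᵥ # 1 ∷ᵥ []ᵥ) (# 3 ∷ᵥ # 5 ∷ᵥ # 1 ∷ᵥ # 4 ∷ᵥ # 0 ∷ᵥ # 2 ∷ᵥ []ᵥ)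

  group : PermGroup 6
  group = listGroup (e ∷ v₁₂ ∷ v₁₃ ∷ v₁₄ ∷ c₂₃₄ ∷ c₂₄₃ ∷ c₁₂₃ ∷ c₁₃₂ ∷ c₁₂₄ ∷ c₁₄₂ ∷ c₁₃₄ ∷ c₁₄₃ ∷ [])

  -- The Klein four-group: each of its non-identity elements fixes two
  -- 2-subsets, and it is closed under quotients x y⁻¹.
  V₄ : List (Permutation′ 6)
  V₄ = e ∷ v₁₂ ∷ v₁₃ ∷ v₁₄ ∷ []

  example : Example 2 4
  example = checked-example group V₄ (# 0)

power-example : ∀ k → Example (2 ^ k) (4 ^ k)
power-example zero    = trivial-example
power-example (suc k) = product-example A₄.example (power-example k)

n<2^n : ∀ n → n ℕ.< 2 ^ n
n<2^n zero    = ℕ.s≤s ℕ.z≤n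
n<2^n (suc n) = +-mono-≤ (m^n>0 2 n) (≤-trans (n<2^n n) (m≤m+n (2 ^ n) 0))

4^n≡2^n*2^n : ∀ n → 4 ^ n ≡ 2 ^ n ℕ.* 2 ^ n
4^n≡2^n*2^n n = begin
  (2 ^ 2) ^ n            ≡⟨ ℕₚ.^-*-assoc 2 2 n ⟩
  2 ^ (n ℕ.+ (n ℕ.+ 0))  ≡⟨ cong (λ j → 2 ^ (n ℕ.+ j)) (ℕₚ.+-identityʳ n) ⟩
  2 ^ (n ℕ.+ n)          ≡⟨ ℕₚ.^-distribˡ-+-* 2 n n ⟩
  2 ^ n ℕ.* 2 ^ n        ∎
  where open ≡-Reasoning

coprime-1 : ∀ a → Coprimality.Coprime a 1
coprime-1 a = Coprimality.sym (Coprimality.1-coprimeTo a)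

/1-normal : ∀ a → + a / 1 ≡ mkℚ (+ a) 0 (coprime-1 a)
/1-normal a = normalize-coprime (coprime-1 a)

-- A positive rational M = p / q (q ≥ 1) satisfies M · s < t whenever p · s < t:
-- after cross-multiplying this reads p · s < t · q, and t ≤ t · q.
numerator-bound : (M : ℚ) → 0ℚ < M → ∀ s t → ℤ.∣ ↥ M ∣ ℕ.* s ℕ.< t → M * (+ s / 1) < + t / 1
numerator-bound M@(mkℚ +[1+ p ] q _) _ s t ps<t rewrite /1-normal s | /1-normal t =
  toℚᵘ-cancel-< (ℚᵘₚ.<-respˡ-≃ (ℚᵘₚ.≃-sym (toℚᵘ-homo-* M (mkℚ (+ s) 0 (coprime-1 s)))) (ℚᵘ.*<* cross))
  where
  cross-ℕ : suc p ℕ.* s ℕ.* 1 ℕ.< t ℕ.* (suc q ℕ.* 1)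
  cross-ℕ = begin-strict
    suc p ℕ.* s ℕ.* 1  ≡⟨ ℕₚ.*-identityʳ _ ⟩
    suc p ℕ.* s        <⟨ ps<t ⟩
    t                  ≤⟨ ℕₚ.m≤m*n t (suc q ℕ.* 1) ⟩
    t ℕ.* (suc q ℕ.* 1) ∎
    where open ℕₚ.≤-Reasoning

  cross : (+[1+ p ] ℤ.* + s) ℤ.* + 1 ℤ.< + t ℤ.* + (suc q ℕ.* 1)
  cross = subst₂ ℤ._<_
    (trans (ℤₚ.pos-* (suc p ℕ.* s) 1) (cong (ℤ._* + 1) (ℤₚ.pos-* (suc p) s)))
    (ℤₚ.pos-* t (suc q ℕ.* 1))
    (ℤ.+<+ cross-ℕ)
numerator-bound (mkℚ (+ zero)    _ _) (ℚ*<* (ℤ.+<+ ()))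
numerator-bound (mkℚ ℤ.-[1+ _ ] _ _) (ℚ*<* ())

-- Main theorem: for k = numerator(M), the power A₄ᵏ with the intersecting
-- set V₄ᵏ works, since numerator(M) · 2ᵏ < 2ᵏ · 2ᵏ = 4ᵏ.
theorem1p1 : (M : ℚ) → 0ℚ < M →
    Σ ℕ λ n → Σ (PermGroup n) λ G → Σ (List (Permutation′ n)) λ S → Σ (Fin n) λ ω →
      Transitive G × IntersectingSet G S ×
      (M * ((+ length (stabiliser G ω)) / 1) < (+ length S) / 1)
theorem1p1 M 0<M = E.degree , E.group , E.set , E.point , E.transitive , E.intersecting , bound
  where
  k : ℕ
  k = ℤ.∣ ↥ M ∣

  module E = Example (power-example k)

  k·2ᵏ<4ᵏ : k ℕ.* 2 ^ k ℕ.< 4 ^ k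
  k·2ᵏ<4ᵏ = subst (k ℕ.* 2 ^ k ℕ.<_) (sym (4^n≡2^n*2^n k))
    (ℕₚ.*-monoˡ-< (2 ^ k) {{m^n≢0 2 k}} (n<2^n k))

  bound : M * (+ length (stabiliser E.group E.point) / 1) < + length E.set / 1
  bound rewrite E.stab-order | E.set-size = numerator-bound M 0<M (2 ^ k) (4 ^ k) k·2ᵏ<4ᵏ
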